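{- For all $n\ge 3$ and $k\ge 0$, \[ A_n[1,f_n-1] = A_{n+k}[1,f_n-1] \] and \[ A_n[2,f_n] = A_{n+k}[f_{n+k}-f_n+2,\,f_{n+k}]. \]
   Context: Words are finite sequences over $\{0,1\}$; for sets of words $UV=\{uv:u\in U,v\in V\}$. For a word $w=w_1\cdots w_m$ and $1\le a\le b\le m$, $w[a,b]=w_aw_{a+1}\cdots w_b$, and for a set of words $W$, $W[a,b]=\{w[a,b]:w\in W\}$. Define $A_1=\{0\}$, $A_2=\{1\}$ and for $n\ge3$, $A_n=A_{n-1}A_{n-2}\cup A_{n-2}A_{n-1}$. All words of $A_n$ have a common length $f_n$ (the Fibonacci numbers: $f_1=f_2=1$, $f_n=f_{n-1}+f_{n-2}$). -}

module Defs where

open import Data.Nat using (ℕ; zero; suc; _+_; _∸_)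
open import Data.Bool using (Bool; true; false)
open import Data.List using (List; []; _∷_; _++_; take; drop)
open import Data.Product using (Σ; _×_; ∃-syntax)
open import Relation.Binary.PropositionalEquality using (_≡_)

-- Words over {0,1}: lists of Bool (false = 0, true = 1).
Word : Set
Word = List Bool

WordSet : Set₁
WordSet = Word → Set

fib : ℕ → ℕ
fib 0 = 0
fib 1 = 1
fib (suc (suc n)) = fib (suc n) + fib n

_·_ : WordSet → WordSet → WordSet
(U · V) w = ∃[ u ] ∃[ v ] (U u × V v × w ≡ u ++ v)

data A : ℕ → Word → Set where
  A1   : A 1 (false ∷ [])
  A2   : A 2 (true ∷ [])
  Aᵃ   : ∀ {n u v} → A (suc (suc n)) u → A (suc n) v → A (suc (suc (suc n))) (u ++ v)
  Aᵇ   : ∀ {n u v} → A (suc n) u → A (suc (suc n)) v → A (suc (suc (suc n))) (u ++ v)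

-- Factor w[a,b] = w_a ⋯ w_b (1-indexed, inclusive).
factor : ℕ → ℕ → Word → Word
factor a b w = take (suc b ∸ a) (drop (a ∸ 1) w)

restrict : WordSet → ℕ → ℕ → WordSet
restrict W a b v = ∃[ w ] (W w × v ≡ factor a b w)

_≐_ : WordSet → WordSet → Set
U ≐ V = (∀ w → U w → V w) × (∀ w → V w → U w)

-- Every word of A_m extends to the right (and, by symmetry, to the left) to a word of A_j for
-- j ≥ m, so the prefixes of A_m are prefixes of A_j. Conversely, a prefix of length f_m − 1 of a
-- word of A_j already is a prefix of a word of A_m: decompose w = uv along its derivation; if
-- the first factor lies in A_i with i ≥ m the prefix lies inside it, and otherwise w = uv with
-- u ∈ A_{m−1}, v ∈ A_m, so the prefix is u followed by a prefix of length f_{m−2} − 1 of v,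
-- which by induction extends to a word of A_{m−2}, and then u·A_{m−2} ⊆ A_m. The sets A_n are
-- closed under reversal, which turns the statement about suffixes into the one about prefixes.
module Submission where

open import Defs
open import Data.Nat using (ℕ; zero; suc; _+_; _∸_; _≤_; _≤′_; ≤′-refl; ≤′-step; z≤n; s≤s)
open import Data.Nat.Properties
open import Data.Product using (_×_; _,_; proj₂; ∃-syntax)
open import Data.Sum using (inj₁; inj₂)
open import Data.List using (List; []; _∷_; _++_; take; drop; length; reverse)
open import Data.List.Properties
  using (++-assoc; ++-identityʳ; length-++; length-take; length-drop; take-all; take++drop≡id;
         reverse-++; reverse-involutive; length-reverse)
open import Function using (_∘_)
open import Relation.Binary.PropositionalEquality

module _ {ℓ} {X : Set ℓ} where

  take-++ˡ : ∀ n (xs ys : List X) → n ≤ length xs → take n (xs ++ ys) ≡ take n xs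
  take-++ˡ zero    xs       ys _         = refl
  take-++ˡ (suc n) (x ∷ xs) ys (s≤s n≤∣xs∣) = cong (x ∷_) (take-++ˡ n xs ys n≤∣xs∣)

  take-++ʳ : ∀ n (xs ys : List X) → take (length xs + n) (xs ++ ys) ≡ xs ++ take n ys
  take-++ʳ n []       ys = refl
  take-++ʳ n (x ∷ xs) ys = cong (x ∷_) (take-++ʳ n xs ys)

  take-length-++ : ∀ {n} (xs ys : List X) → length xs ≡ n → take n (xs ++ ys) ≡ xs
  take-length-++ xs ys refl = trans (take-++ˡ (length xs) xs ys ≤-refl) (take-all (length xs) xs ≤-refl)

  drop-length-++ : ∀ {n} (xs ys : List X) → length xs ≡ n → drop n (xs ++ ys) ≡ ys
  drop-length-++ []       ys refl = refl
  drop-length-++ (x ∷ xs) ys refl = drop-length-++ xs ys refl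

IsPrefixIn : WordSet → Word → Set
IsPrefixIn W s = ∃[ q ] W (s ++ q)

IsSuffixIn : WordSet → Word → Set
IsSuffixIn W s = ∃[ p ] W (p ++ s)

Prefixes : ℕ → WordSet → WordSet
Prefixes l W s = length s ≡ l × IsPrefixIn W s

Suffixes : ℕ → WordSet → WordSet
Suffixes l W s = length s ≡ l × IsSuffixIn W s

≐-sym : ∀ {U V} → U ≐ V → V ≐ U
≐-sym (U⊆V , V⊆U) = V⊆U , U⊆V

≐-trans : ∀ {U V W} → U ≐ V → V ≐ W → U ≐ W
≐-trans (U⊆V , V⊆U) (V⊆W , W⊆V) = (λ w → V⊆W w ∘ U⊆V w) , (λ w → V⊆U w ∘ W⊆V w)

fib-mono-suc : ∀ n → fib n ≤ fib (suc n)
fib-mono-suc zero    = z≤n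
fib-mono-suc (suc n) = m≤m+n (fib (suc n)) (fib n)

fib-mono : ∀ {m n} → m ≤ n → fib m ≤ fib n
fib-mono m≤n = go (≤⇒≤′ m≤n)
  where
  go : ∀ {m n} → m ≤′ n → fib m ≤ fib n
  go ≤′-refl          = ≤-refl
  go (≤′-step {n} m≤′n) = ≤-trans (go m≤′n) (fib-mono-suc n)

fib-pos : ∀ {n} → 1 ≤ n → 1 ≤ fib n
fib-pos {suc n} _ = fib-mono (s≤s (z≤n {n}))

length-A : ∀ {n w} → A n w → length w ≡ fib n
length-A A1 = refl
length-A A2 = refl
length-A (Aᵃ {u = u} Au Av) = trans (length-++ u) (cong₂ _+_ (length-A Au) (length-A Av))
length-A (Aᵇ {n} {u} {v} Au Av) = begin
  length (u ++ v)                ≡⟨ length-++ u ⟩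
  length u + length v            ≡⟨ cong₂ _+_ (length-A Au) (length-A Av) ⟩
  fib (suc n) + fib (suc (suc n)) ≡⟨ +-comm (fib (suc n)) _ ⟩
  fib (suc (suc (suc n)))        ∎
  where open ≡-Reasoning

A-nonempty : ∀ n → ∃[ w ] A (suc n) w
A-nonempty zero          = _ , A1
A-nonempty (suc zero)    = _ , A2
A-nonempty (suc (suc n)) = _ , Aᵃ (proj₂ (A-nonempty (suc n))) (proj₂ (A-nonempty n))

A-reverse : ∀ {n w} → A n w → A n (reverse w)
A-reverse A1 = A1
A-reverse A2 = A2
A-reverse (Aᵃ {u = u} {v} Au Av) = subst (A _) (sym (reverse-++ u v)) (Aᵇ (A-reverse Av) (A-reverse Au))
A-reverse (Aᵇ {u = u} {v} Au Av) = subst (A _) (sym (reverse-++ u v)) (Aᵃ (A-reverse Av) (A-reverse Au))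

A-extend : ∀ {m j u} → m ≤′ j → A (suc (suc m)) u → ∃[ q ] A (suc (suc j)) (u ++ q)
A-extend {u = u} ≤′-refl Au = [] , subst (A _) (sym (++-identityʳ u)) Au
A-extend {u = u} (≤′-step {j} m≤′j) Au with A-extend m≤′j Au | A-nonempty j
... | q , Auq | z , Az = q ++ z , subst (A _) (++-assoc u q z) (Aᵃ Auq Az)

prefix-fits : ∀ {j m u} → A j u → m ≤ j → fib m ∸ 1 ≤ length u
prefix-fits {m = m} Au m≤j =
  ≤-trans (m∸n≤m (fib m) 1) (≤-trans (fib-mono m≤j) (≤-reflexive (sym (length-A Au))))

take-IsPrefixIn-A-self : ∀ {m w} → A m w → IsPrefixIn (A m) (take (fib m ∸ 1) w)
take-IsPrefixIn-A-self {m} {w} Aw = drop (fib m ∸ 1) w , subst (A m) (sym (take++drop≡id (fib m ∸ 1) w)) Aw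

take-IsPrefixIn-A : ∀ {j m w} → A j w → 1 ≤ m → m ≤ j → IsPrefixIn (A m) (take (fib m ∸ 1) w)
take-IsPrefixIn-A {m = 1} _ _ _ = _ , A1
take-IsPrefixIn-A {m = 2} _ _ _ = _ , A2
take-IsPrefixIn-A {m = suc (suc (suc _))} A1 _ (s≤s ())
take-IsPrefixIn-A {m = suc (suc (suc _))} A2 _ (s≤s (s≤s ()))
take-IsPrefixIn-A {m = m@(suc (suc (suc _)))} (Aᵃ {u = u} {v} Au Av) 1≤m m≤j with m≤n⇒m<n∨m≡n m≤j
... | inj₁ (s≤s m≤i) = subst (IsPrefixIn (A m)) (sym (take-++ˡ _ u v (prefix-fits Au m≤i)))
                             (take-IsPrefixIn-A Au 1≤m m≤i)
... | inj₂ refl      = take-IsPrefixIn-A-self (Aᵃ Au Av)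
take-IsPrefixIn-A {m = m@(suc (suc (suc m′)))} (Aᵇ {u = u} {v} Au Av) 1≤m m≤j with m≤n⇒m<n∨m≡n m≤j
... | inj₂ refl      = take-IsPrefixIn-A-self (Aᵇ Au Av)
... | inj₁ (s≤s m≤j′) with m≤n⇒m<n∨m≡n m≤j′
...   | inj₁ (s≤s m≤i) = subst (IsPrefixIn (A m)) (sym (take-++ˡ _ u v (prefix-fits Au m≤i)))
                               (take-IsPrefixIn-A Au 1≤m m≤i)
-- here u ∈ A_{m−1} and v ∈ A_m: the prefix is u followed by a prefix of v of length f_{m−2} − 1
...   | inj₂ refl with take-IsPrefixIn-A Av (s≤s z≤n) (≤-trans (n≤1+n _) (n≤1+n _))
...     | q , Aq = q , subst (A m) straddle (Aᵃ Au Aq)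
  where
  straddle : u ++ (take (fib (suc m′) ∸ 1) v ++ q) ≡ take (fib m ∸ 1) (u ++ v) ++ q
  straddle = begin
    u ++ (take (fib (suc m′) ∸ 1) v ++ q)               ≡⟨ ++-assoc u _ q ⟨
    (u ++ take (fib (suc m′) ∸ 1) v) ++ q               ≡⟨ cong (_++ q) (take-++ʳ _ u v) ⟨
    take (length u + (fib (suc m′) ∸ 1)) (u ++ v) ++ q  ≡⟨ cong (λ i → take i (u ++ v) ++ q) length-u ⟩
    take (fib m ∸ 1) (u ++ v) ++ q                      ∎
    where
    open ≡-Reasoning
    length-u : length u + (fib (suc m′) ∸ 1) ≡ fib m ∸ 1
    length-u = trans (cong (_+ _) (length-A Au)) (sym (+-∸-assoc _ (fib-pos {suc m′} (s≤s z≤n))))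

IsPrefixIn-A-ascend : ∀ {m j s} → m ≤′ j → IsPrefixIn (A (suc (suc m))) s → IsPrefixIn (A (suc (suc j))) s
IsPrefixIn-A-ascend {s = s} m≤′j (q , Asq) with A-extend m≤′j Asq
... | q′ , Asqq′ = q ++ q′ , subst (A _) (++-assoc s q q′) Asqq′

IsPrefixIn-A-descend : ∀ {m j s} → 1 ≤ m → m ≤ j → length s ≡ fib m ∸ 1 →
                       IsPrefixIn (A j) s → IsPrefixIn (A m) s
IsPrefixIn-A-descend {m} {s = s} 1≤m m≤j ∣s∣ (q , Asq) =
  subst (IsPrefixIn (A m)) (take-length-++ s q ∣s∣) (take-IsPrefixIn-A Asq 1≤m m≤j)

IsSuffixIn⇒IsPrefixIn-reverse : ∀ {n s} → IsSuffixIn (A n) s → IsPrefixIn (A n) (reverse s)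
IsSuffixIn⇒IsPrefixIn-reverse {n} {s} (p , Aps) =
  reverse p , subst (A n) (reverse-++ p s) (A-reverse Aps)

IsPrefixIn-reverse⇒IsSuffixIn : ∀ {n s} → IsPrefixIn (A n) (reverse s) → IsSuffixIn (A n) s
IsPrefixIn-reverse⇒IsSuffixIn {n} {s} (q , Asq) = reverse q , subst (A n) reversed (A-reverse Asq)
  where
  reversed : reverse (reverse s ++ q) ≡ reverse q ++ s
  reversed = trans (reverse-++ (reverse s) q) (cong (reverse q ++_) (reverse-involutive s))

Prefixes-A-stable : ∀ {m j} → m ≤ j →
  Prefixes (fib (suc (suc m)) ∸ 1) (A (suc (suc m))) ≐ Prefixes (fib (suc (suc m)) ∸ 1) (A (suc (suc j)))
Prefixes-A-stable m≤j =
    (λ _ (∣s∣ , s∈) → ∣s∣ , IsPrefixIn-A-ascend (≤⇒≤′ m≤j) s∈)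
  , (λ _ (∣s∣ , s∈) → ∣s∣ , IsPrefixIn-A-descend (s≤s z≤n) (s≤s (s≤s m≤j)) ∣s∣ s∈)

Suffixes-A-stable : ∀ {m j} → m ≤ j →
  Suffixes (fib (suc (suc m)) ∸ 1) (A (suc (suc m))) ≐ Suffixes (fib (suc (suc m)) ∸ 1) (A (suc (suc j)))
Suffixes-A-stable m≤j =
    (λ _ (∣s∣ , s∈) → ∣s∣ , IsPrefixIn-reverse⇒IsSuffixIn
                               (IsPrefixIn-A-ascend (≤⇒≤′ m≤j) (IsSuffixIn⇒IsPrefixIn-reverse s∈)))
  , (λ s (∣s∣ , s∈) → ∣s∣ , IsPrefixIn-reverse⇒IsSuffixIn
                               (IsPrefixIn-A-descend (s≤s z≤n) (s≤s (s≤s m≤j))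
                                 (trans (length-reverse s) ∣s∣) (IsSuffixIn⇒IsPrefixIn-reverse s∈)))

restrict-1≐Prefixes : ∀ {W l} → (∀ {w} → W w → l ≤ length w) → restrict W 1 l ≐ Prefixes l W
restrict-1≐Prefixes {W} {l} fits = to , from
  where
  to : ∀ s → restrict W 1 l s → Prefixes l W s
  to _ (w , Ww , refl) =
    trans (length-take l w) (m≤n⇒m⊓n≡m (fits Ww)) , drop l w , subst W (sym (take++drop≡id l w)) Ww
  from : ∀ s → Prefixes l W s → restrict W 1 l s
  from s (∣s∣ , q , Wsq) = s ++ q , Wsq , sym (take-length-++ s q ∣s∣)

restrict≐Suffixes : ∀ {W L l a} → (∀ {w} → W w → length w ≡ L) → l ≤ L → a ≡ suc (L ∸ l) →
                    restrict W a L ≐ Suffixes l W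
restrict≐Suffixes {W} {L} {l} length-W l≤L refl = to , from
  where
  length-drop-W : ∀ {w} → W w → length (drop (L ∸ l) w) ≡ L ∸ (L ∸ l)
  length-drop-W {w} Ww = trans (length-drop (L ∸ l) w) (cong (_∸ (L ∸ l)) (length-W Ww))
  factor-drop : ∀ {w} → W w → factor (suc (L ∸ l)) L w ≡ drop (L ∸ l) w
  factor-drop {w} Ww = take-all (L ∸ (L ∸ l)) (drop (L ∸ l) w) (≤-reflexive (length-drop-W Ww))
  to : ∀ s → restrict W (suc (L ∸ l)) L s → Suffixes l W s
  to _ (w , Ww , refl) = subst (Suffixes l W) (sym (factor-drop Ww))
    ( trans (length-drop-W Ww) (m∸[m∸n]≡n l≤L)
    , take (L ∸ l) w , subst W (sym (take++drop≡id (L ∸ l) w)) Ww)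
  from : ∀ s → Suffixes l W s → restrict W (suc (L ∸ l)) L s
  from s (∣s∣ , p , Wps) = p ++ s , Wps , sym (trans (factor-drop Wps) (drop-length-++ p s ∣p∣))
    where
    ∣p∣ : length p ≡ L ∸ l
    ∣p∣ = begin
      length p                ≡⟨ m+n∸n≡m (length p) l ⟨
      length p + l ∸ l        ≡⟨ cong (λ i → length p + i ∸ l) ∣s∣ ⟨
      length p + length s ∸ l ≡⟨ cong (_∸ l) (length-++ p) ⟨
      length (p ++ s) ∸ l     ≡⟨ cong (_∸ l) (length-W Wps) ⟩
      L ∸ l                   ∎
      where open ≡-Reasoning

suffix-start : ∀ {f F} → 1 ≤ f → f ≤ F → F ∸ f + 2 ≡ suc (F ∸ (f ∸ 1))
suffix-start {suc g} {F} _ f≤F = begin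
  F ∸ suc g + 2         ≡⟨ +-comm (F ∸ suc g) 2 ⟩
  suc (1 + (F ∸ suc g)) ≡⟨ cong suc (+-∸-assoc 1 f≤F) ⟨
  suc (F ∸ g)           ∎
  where open ≡-Reasoning

proposition5 : ∀ (n k : ℕ) → 3 ≤ n →
    (restrict (A n) 1 (fib n ∸ 1) ≐ restrict (A (n + k)) 1 (fib n ∸ 1))
    × (restrict (A n) 2 (fib n) ≐ restrict (A (n + k)) (fib (n + k) ∸ fib n + 2) (fib (n + k)))
proposition5 n@(suc (suc m)) k (s≤s (s≤s _)) =
    ≐-trans (restrict-1≐Prefixes (λ Aw → prefix-fits Aw ≤-refl))
      (≐-trans (Prefixes-A-stable m≤m+k) (≐-sym (restrict-1≐Prefixes (λ Aw → prefix-fits Aw n≤n+k))))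
  , ≐-trans (restrict≐Suffixes length-A (m∸n≤m (fib n) 1) (sym (cong suc (m∸[m∸n]≡n 1≤f))))
      (≐-trans (Suffixes-A-stable m≤m+k)
        (≐-sym (restrict≐Suffixes length-A (≤-trans (m∸n≤m (fib n) 1) (fib-mono n≤n+k))
                                  (suffix-start 1≤f (fib-mono n≤n+k)))))
  where
  m≤m+k : m ≤ m + k
  m≤m+k = m≤m+n m k
  n≤n+k : n ≤ n + k
  n≤n+k = m≤m+n n k
  1≤f : 1 ≤ fib n
  1≤f = fib-pos {n} (s≤s z≤n)
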